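{- For every $d,r,m\in\mathbb{N}$ with $d\ge1$, Localiser has a strategy in the $m$-batched splitter game with radius $d\cdot(r+1)$ to make the game last at least $d+1$ rounds (i.e., Splitter does not win within $d$ rounds) on any ${\le}r$-subdivision of $T^{d+1}_{m+1}$.
   Context: Graphs are finite, simple, undirected. A rooted tree has depth equal to the maximum number of vertices on a root-to-leaf path; $T^d_k$ is the rooted tree of depth $d$ in which every non-leaf node has exactly $k$ children. A ${\le}r$-subdivision of $H$ is obtained by replacing each edge $uv$ of $H$ by a $u$–$v$ path with at most $r$ internal vertices. $B^G_\rho(v)$ is the subgraph of $G$ induced by vertices at distance at most $\rho$ from $v$. The $m$-batched splitter game with radius $\rho$ on $G$: $G_0:=G$; in round $i\ge1$, Localiser picks $v\in V(G_{i-1})$ and sets $G'_{i-1}:=B^{G_{i-1}}_\rho(v)$, then Splitter removes at most $m$ vertices from $G'_{i-1}$ to obtain $G_i$; Splitter wins when $V(G_i)=\emptyset$. -}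

module Defs where

open import Data.Nat using (ℕ; zero; suc; _<_; _≤_)
open import Data.Fin using (Fin; toℕ)
open import Data.List using (List; []; _∷_; length)
open import Data.List.Membership.Propositional using (_∉_)
open import Data.Product using (Σ; ∃; _×_; _,_)
open import Data.Sum using (_⊎_)
open import Data.Unit using (⊤)
open import Relation.Nullary using (¬_)
open import Relation.Binary.PropositionalEquality using (_≡_)
open import Function.Bundles using (_↔_; Inverse)

record RawGraph : Set₁ where
  field
    V : Set
    E : V → V → Set

record Graph : Set₁ where
  field
    raw    : RawGraph
  open RawGraph raw public
  field
    sym    : ∀ {x y} → E x y → E y x
    irrefl : ∀ {x} → ¬ E x x

_≅_ : RawGraph → RawGraph → Set
G ≅ H = Σ (RawGraph.V G ↔ RawGraph.V H) λ f →
          ∀ x y → (RawGraph.E G x y → RawGraph.E H (Inverse.to f x) (Inverse.to f y))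
                × (RawGraph.E H (Inverse.to f x) (Inverse.to f y) → RawGraph.E G x y)

-- Nodes of T^D_k are the lists over Fin k of length < D (the address of a
-- node, written from the node up to the root); the root is [], and the
-- children of p are i ∷ p for i : Fin k (provided the length stays < D).
-- So T^D_k has depth D (counting vertices) and every non-leaf node has k
-- children.  Every edge of T^D_k is {p , i ∷ p} and is identified by its
-- lower endpoint i ∷ p.
--
-- Given ℓ, the subdivision replaces the edge {p , i ∷ p} by a path
--   p — mid i p 0 — mid i p 1 — … — mid i p (ℓ(i∷p) - 1) — i ∷ p
-- with ℓ (i ∷ p) internal vertices.

module SubdivTreeDef (D k : ℕ) (ℓ : List (Fin k) → ℕ) where

  data SV : Set where
    node : (p : List (Fin k)) → length p < D → SV
    mid  : (i : Fin k) (p : List (Fin k)) → length (i ∷ p) < D →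
           Fin (ℓ (i ∷ p)) → SV

  data Arc : SV → SV → Set where
    direct : ∀ i p hp hc → ℓ (i ∷ p) ≡ 0 →
             Arc (node p hp) (node (i ∷ p) hc)
    enter  : ∀ i p hp hc (j : Fin (ℓ (i ∷ p))) → toℕ j ≡ 0 →
             Arc (node p hp) (mid i p hc j)
    along  : ∀ i p hc (j j' : Fin (ℓ (i ∷ p))) → toℕ j' ≡ suc (toℕ j) →
             Arc (mid i p hc j) (mid i p hc j')
    exit   : ∀ i p hc hc' (j : Fin (ℓ (i ∷ p))) → suc (toℕ j) ≡ ℓ (i ∷ p) →
             Arc (mid i p hc j) (node (i ∷ p) hc')

  Adj : SV → SV → Set
  Adj x y = Arc x y ⊎ Arc y x

-- The ≤r-subdivision of T^D_k with edge-lengths ℓ (the ≤r bound is imposed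
-- separately as the hypothesis ∀ p → ℓ p ≤ r).
SubdivTree : (D k : ℕ) → (List (Fin k) → ℕ) → RawGraph
SubdivTree D k ℓ = record { V = SubdivTreeDef.SV D k ℓ ; E = SubdivTreeDef.Adj D k ℓ }

-- Every G_i is an induced subgraph of G, so a position is a vertex
-- predicate S : V → Set (the current graph is G[S]).

module Game (G : Graph) where
  open Graph G

  data Walk (S : V → Set) : ℕ → V → V → Set where
    here : ∀ {n v} → S v → Walk S n v v
    step : ∀ {n v y z} → Walk S n v y → E y z → S z → Walk S (suc n) v z

  Ball : (S : V → Set) → ℕ → V → V → Set
  Ball S ρ v x = Walk S ρ v x

  -- LocSurvives m ρ k S : in the m-batched game with radius ρ started on
  -- G[S], Localiser has a strategy such that G_0, …, G_k are all nonempty,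
  -- i.e. Splitter does not win within k rounds.
  LocSurvives : (m ρ : ℕ) → ℕ → (V → Set) → Set
  LocSurvives m ρ zero    S = ∃ λ v → S v
  LocSurvives m ρ (suc k) S =
    ∃ λ v → S v × ((X : List V) → length X ≤ m →
                   LocSurvives m ρ k (λ x → Ball S ρ v x × x ∉ X))

LocaliserLasts : (G : Graph) (m ρ k : ℕ) → Set
LocaliserLasts G m ρ k = Game.LocSurvives G m ρ k (λ _ → ⊤)

module Submission where

-- Localiser always plays the node of the subdivided tree at which the current
-- subtree is rooted.  Starting at the root, the whole tree lies within distance
-- d(r+1) of the centre, so the ball is everything.  Splitter deletes at most m
-- vertices, but the centre has m+1 child subtrees, so one of them is untouched;
-- its root is the next centre.  After j rounds the untouched subtree is rooted at
-- depth j, so for j ≤ d it is still nonempty.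

open import Defs
open import Data.Nat using (ℕ; zero; suc; _*_; _+_; _∸_; _≤_; _<_; s≤s; z≤n)
open import Data.Nat.Properties
open import Data.Fin using (Fin; toℕ; fromℕ<)
import Data.Fin.Properties as FinP
open FinP using (toℕ-fromℕ<; fromℕ<-toℕ; toℕ<n; ¬∀⟶∃¬; injective⇒≤)
open import Data.List using (List; []; _∷_; [_]; _++_; length; map; drop; head; lookup)
open import Data.List.Properties using (length-++; length-map; ++-assoc)
open import Data.List.Membership.Propositional using (_∈_; _∉_)
import Data.List.Membership.DecPropositional as DecMembership
open import Data.List.Membership.Propositional.Properties using (∈-map⁺)
open import Data.List.Relation.Unary.Any using (index)
open import Data.List.Relation.Unary.Any.Properties using (lookup-index)
open import Data.Maybe using (fromMaybe)
open import Data.Product using (∃; _×_; _,_; proj₁; proj₂)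
open import Data.Sum using (inj₁; inj₂)
open import Data.Unit using (tt)
open import Data.Empty using (⊥)
open import Function using (_∘_)
open import Function.Bundles using (Inverse)
open import Relation.Binary.PropositionalEquality using (_≡_; refl; sym; trans; cong; subst; subst₂)

length<⇒∃∉ : ∀ {n} (xs : List (Fin n)) → length xs < n → ∃ λ i → i ∉ xs
length<⇒∃∉ {n} xs |xs|<n = ¬∀⟶∃¬ n (_∈ xs) (_∈? xs) ¬all∈
  where
  open DecMembership (FinP._≟_ {n}) using (_∈?_)
  ¬all∈ : (∀ i → i ∈ xs) → ⊥
  ¬all∈ all∈ = <⇒≱ |xs|<n (injective⇒≤ position-injective)
    where
    position-injective : ∀ {i j} → index (all∈ i) ≡ index (all∈ j) → i ≡ j
    position-injective {i} {j} eq =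
      trans (lookup-index (all∈ i)) (trans (cong (lookup xs) eq) (sym (lookup-index (all∈ j))))

drop-length-++ : ∀ {A : Set} (xs ys : List A) → drop (length xs) (xs ++ ys) ≡ ys
drop-length-++ []       ys = refl
drop-length-++ (x ∷ xs) ys = drop-length-++ xs ys

module _ (G : Graph) where
  open Game G

  walk-weaken : ∀ {S n n′ v x} → Walk S n v x → n ≤ n′ → Walk S n′ v x
  walk-weaken (here v∈S)     _          = here v∈S
  walk-weaken (step w e z∈S) (s≤s n≤n′) = step (walk-weaken w n≤n′) e z∈S

module LocaliserStrategy
  (d r m : ℕ) (G : Graph) (ℓ : List (Fin (suc m)) → ℕ) (ℓ≤r : ∀ p → ℓ p ≤ r)
  (iso : Graph.raw G ≅ SubdivTree (suc d) (suc m) ℓ) where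

  open SubdivTreeDef (suc d) (suc m) ℓ
  open Game G
  open Graph G using (V; E)

  Address : Set
  Address = List (Fin (suc m))

  to : V → SV
  to = Inverse.to (proj₁ iso)

  from : SV → V
  from = Inverse.from (proj₁ iso)

  to∘from : ∀ a → to (from a) ≡ a
  to∘from = Inverse.strictlyInverseˡ (proj₁ iso)

  from-Adj : ∀ {a b} → Adj a b → E (from a) (from b)
  from-Adj {a} {b} a~b =
    proj₂ (proj₂ iso (from a) (from b)) (subst₂ Adj (sym (to∘from a)) (sym (to∘from b)) a~b)

  anchor : SV → Address
  anchor (node q _)    = q
  anchor (mid _ q _ _) = q

  Below : Address → SV → Set
  Below p a = ∃ λ s → anchor a ≡ s ++ p

  Below-∷ : ∀ {i p} a → Below (i ∷ p) a → Below p a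
  Below-∷ {i} {p} a (s , eq) = s ++ [ i ] , trans eq (sym (++-assoc s [ i ] p))

  -- The child of p through which q descends (junk if q is not strictly below p).
  branch : Address → Address → Fin (suc m)
  branch p q = fromMaybe Data.Fin.zero (head (drop (length q ∸ suc (length p)) q))

  branch-++ : ∀ s i p → branch p (s ++ i ∷ p) ≡ i
  branch-++ s i p
    rewrite length-++ s {i ∷ p}
          | m+n∸n≡m (length s) (suc (length p))
          | drop-length-++ s (i ∷ p) = refl

  branch-Below : ∀ {i p} a → Below (i ∷ p) a → branch p (anchor a) ≡ i
  branch-Below {i} {p} a (s , eq) = trans (cong (branch p) eq) (branch-++ s i p)

  depth-bound : ∀ (s p : Address) → length (s ++ p) < suc d → length s ≤ d
  depth-bound s p hq =
    ≤-pred (≤-trans (s≤s (≤-trans (m≤m+n _ (length p)) (≤-reflexive (sym (length-++ s))))) hq)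

  module Reach (S : V → Set) (p : Address) (hp : length p < suc d)
               (Below⊆S : ∀ a → Below p a → S (from a)) where

    centre : V
    centre = from (node p hp)

    along-edge : ∀ s hq j hc {n} → Walk S n centre (from (node (s ++ p) hq)) →
                 ∀ t (t<ℓ : t < ℓ (j ∷ s ++ p)) →
                 Walk S (suc t + n) centre (from (mid j (s ++ p) hc (fromℕ< t<ℓ)))
    along-edge s hq j hc w zero t<ℓ =
      step w (from-Adj (inj₁ (enter j _ hq hc _ (toℕ-fromℕ< t<ℓ)))) (Below⊆S _ (s , refl))
    along-edge s hq j hc w (suc t) t+1<ℓ =
      step (along-edge s hq j hc w t t<ℓ) (from-Adj (inj₁ (along j _ hc _ _ consecutive)))
           (Below⊆S _ (s , refl))
      where
      t<ℓ : t < ℓ (j ∷ s ++ p)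
      t<ℓ = <-trans (n<1+n t) t+1<ℓ
      consecutive : toℕ (fromℕ< t+1<ℓ) ≡ suc (toℕ (fromℕ< t<ℓ))
      consecutive = trans (toℕ-fromℕ< t+1<ℓ) (cong suc (sym (toℕ-fromℕ< t<ℓ)))

    to-child : ∀ s hq j hc {n} → Walk S n centre (from (node (s ++ p) hq)) →
               Walk S (suc r + n) centre (from (node (j ∷ s ++ p) hc))
    to-child s hq j hc {n} w = by-length (ℓ (j ∷ s ++ p)) refl
      where
      child∈S : S (from (node (j ∷ s ++ p) hc))
      child∈S = Below⊆S _ (j ∷ s , refl)

      by-length : ∀ L → ℓ (j ∷ s ++ p) ≡ L → Walk S (suc r + n) centre (from (node (j ∷ s ++ p) hc))
      by-length zero    ℓ≡0 =
        walk-weaken G (step w (from-Adj (inj₁ (direct j _ hq hc ℓ≡0))) child∈S) (s≤s (m≤n+m n r))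
      by-length (suc L) ℓ≡1+L =
        walk-weaken G (step (along-edge s hq j hc w L L<ℓ) (from-Adj (inj₁ (exit j _ hc hc _ last))) child∈S)
                      (s≤s (+-monoˡ-≤ n (subst (_≤ r) ℓ≡1+L (ℓ≤r _))))
        where
        L<ℓ : L < ℓ (j ∷ s ++ p)
        L<ℓ = subst (L <_) (sym ℓ≡1+L) ≤-refl
        last : suc (toℕ (fromℕ< L<ℓ)) ≡ ℓ (j ∷ s ++ p)
        last = trans (cong suc (toℕ-fromℕ< L<ℓ)) (sym ℓ≡1+L)

    to-node : ∀ s hq → Walk S (length s * suc r) centre (from (node (s ++ p) hq))
    to-node []      hq = subst (λ h → Walk S 0 centre (from (node p h))) (<-irrelevant hp hq)
                               (here (Below⊆S _ ([] , refl)))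
    to-node (j ∷ s) hc = to-child s hq j hc (to-node s hq)
      where
      hq : length (s ++ p) < suc d
      hq = <-trans (n<1+n _) hc

    Below⊆Ball : ∀ a → Below p a → Ball S (d * suc r) centre (from a)
    Below⊆Ball (node _ hq) (s , refl) =
      walk-weaken G (to-node s hq) (*-monoˡ-≤ (suc r) (depth-bound s p hq))
    -- A vertex inside the edge to the child j ∷ s ++ p is no farther away than that child.
    Below⊆Ball (mid j _ hc t) (s , refl) =
      subst (λ t′ → Walk S (d * suc r) centre (from (mid j (s ++ p) hc t′))) (fromℕ<-toℕ t (toℕ<n t))
        (walk-weaken G (along-edge s hq j hc (to-node s hq) (toℕ t) (toℕ<n t))
          (≤-trans (+-monoˡ-≤ (length s * suc r) (m≤n⇒m≤1+n (≤-trans (toℕ<n t) (ℓ≤r _))))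
                   (*-monoˡ-≤ (suc r) (depth-bound (j ∷ s) p hc))))
      where
      hq : length (s ++ p) < suc d
      hq = <-trans (n<1+n _) hc

  survives : ∀ k p (hp : length p < suc d) → k + length p ≤ d → (S : V → Set) →
             (∀ a → Below p a → S (from a)) → LocSurvives m (d * suc r) k S
  survives zero    p hp _       S Below⊆S = from (node p hp) , Below⊆S _ ([] , refl)
  survives (suc k) p hp k+1+p≤d S Below⊆S = from (node p hp) , Below⊆S _ ([] , refl) , respond
    where
    open Reach S p hp Below⊆S

    respond : (X : List V) → length X ≤ m →
              LocSurvives m (d * suc r) k (λ x → Ball S (d * suc r) centre x × x ∉ X)
    respond X |X|≤m =
      survives k (i ∷ p) hc k+|i∷p|≤d _ λ a a-Below → Below⊆Ball a (Below-∷ a a-Below) , avoids a a-Below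
      where
      classify : V → Fin (suc m)
      classify = branch p ∘ anchor ∘ to

      untouched : ∃ λ i → i ∉ map classify X
      untouched = length<⇒∃∉ (map classify X) (s≤s (≤-trans (≤-reflexive (length-map classify X)) |X|≤m))

      i : Fin (suc m)
      i = proj₁ untouched

      avoids : ∀ a → Below (i ∷ p) a → from a ∉ X
      avoids a a-Below a∈X = proj₂ untouched
        (subst (_∈ map classify X) (trans (cong (branch p ∘ anchor) (to∘from a)) (branch-Below a a-Below))
               (∈-map⁺ classify a∈X))

      hc : suc (length p) < suc d
      hc = s≤s (≤-trans (s≤s (m≤n+m (length p) k)) k+1+p≤d)

      k+|i∷p|≤d : k + suc (length p) ≤ d
      k+|i∷p|≤d = subst (_≤ d) (sym (+-suc k (length p))) k+1+p≤d

lemma4p5 : (d r m : ℕ) → 1 ≤ d →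
           (G : Graph) (ℓ : List (Fin (suc m)) → ℕ) → (∀ p → ℓ p ≤ r) →
           Graph.raw G ≅ SubdivTree (suc d) (suc m) ℓ →
           LocaliserLasts G m (d * suc r) d
lemma4p5 d r m _ G ℓ ℓ≤r iso =
  LocaliserStrategy.survives d r m G ℓ ℓ≤r iso d [] (s≤s z≤n) (≤-reflexive (+-identityʳ d)) _ (λ _ _ → tt)
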